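{- Let $\mathcal{C}$ be a monotone Boolean circuit over a set $\vec{X}$ of variables, let $X\in\vec{X}$, let $w$ be a gate of $\mathcal{C}$, and let $f:\vec{X}\to\{0,1\}$ be an assignment. If $f(w)\neq f(X)$, then $dr(\mathcal{C},X,w,f)=0$.
   Context: A Boolean circuit is monotone if it contains no negation gates (only $\wedge$ and $\vee$ gates). An assignment $f:\vec{X}\to\{0,1\}$ extends to all gates by evaluation. For $\vec{Z}\subseteq\vec{X}$, $\tilde f_{\vec{Z}}$ is the assignment that differs from $f$ exactly on the variables in $\vec{Z}$; $\tilde f_X=\tilde f_{\{X\}}$. $X$ is critical for gate $w$ under $f$ if $\tilde f_X(w)\neq f(w)$. A set $\vec{Z}\subseteq\vec{X}\setminus\{X\}$ makes $X$ critical for $w$ under $f$ if $\tilde f_{\vec{Z}}(w)=f(w)$ and $X$ is critical for $w$ under $\tilde f_{\vec{Z}}$. The degree of responsibility $dr(\mathcal{C},X,w,f)$ is $1/(1+|\vec{Z}|)$ for a minimal-size such $\vec{Z}$, and $0$ if no such set exists. -}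

module Defs where

open import Data.Nat using (ℕ; zero; suc; _⊓_)
open import Data.Fin using (Fin; zero; suc)
open import Data.Bool using (Bool; true; false; _∧_; _∨_; not; _xor_; if_then_else_)
open import Data.Bool.Properties using () renaming (_≟_ to _≟ᵇ_)
open import Data.Vec using (Vec; []; _∷_; lookup)
open import Data.List using (List; []; _∷_; map; _++_)
open import Data.Maybe using (Maybe; just; nothing)
open import Data.Product using (_×_; _,_)
open import Data.Integer using (+_)
open import Data.Rational using (ℚ; 0ℚ; _/_)
open import Data.Fin.Subset using (Subset; _∉_; ∣_∣)
open import Data.Fin.Subset.Properties using (_∈?_)
open import Relation.Binary.PropositionalEquality using (_≡_; _≢_)
open import Relation.Nullary using (Dec; yes; no; ¬_; _×-dec_)
open import Relation.Nullary.Decidable using (¬?)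

Assignment : ℕ → Set
Assignment n = Fin n → Bool

-- There are no negation gates: the circuit is monotone.
data Gate (n k : ℕ) : Set where
  input : Fin n → Gate n k
  and   : Fin k → Fin k → Gate n k
  or    : Fin k → Fin k → Gate n k

-- In  C ▷ g  the newest gate g has index zero, and the gates of C are shifted by suc.
data Circuit (n : ℕ) : ℕ → Set where
  []  : Circuit n zero
  _▷_ : ∀ {m} → Circuit n m → Gate n m → Circuit n (suc m)

evalGate : ∀ {n k} → Gate n k → Assignment n → (Fin k → Bool) → Bool
evalGate (input x) f v = f x
evalGate (and a b) f v = v a ∧ v b
evalGate (or a b)  f v = v a ∨ v b

eval : ∀ {n m} → Circuit n m → Assignment n → Fin m → Bool
eval (C ▷ g) f zero    = evalGate g f (eval C f)
eval (C ▷ g) f (suc i) = eval C f i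

flipSet : ∀ {n} → Subset n → Assignment n → Assignment n
flipSet Z f i = f i xor lookup Z i

flipVar : ∀ {n} → Fin n → Assignment n → Assignment n
flipVar X f i with X Data.Fin.≟ i
... | yes _ = not (f i)
... | no  _ = f i

Critical : ∀ {n m} → Circuit n m → Fin n → Fin m → Assignment n → Set
Critical C X w f = eval C (flipVar X f) w ≢ eval C f w

MakesCritical : ∀ {n m} → Circuit n m → Fin n → Fin m → Assignment n → Subset n → Set
MakesCritical C X w f Z =
  X ∉ Z × (eval C (flipSet Z f) w ≡ eval C f w) × Critical C X w (flipSet Z f)

makesCritical? : ∀ {n m} (C : Circuit n m) X w f Z → Dec (MakesCritical C X w f Z)
makesCritical? C X w f Z =
  ¬? (X ∈? Z) ×-dec ((eval C (flipSet Z f) w ≟ᵇ eval C f w)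
    ×-dec ¬? (eval C (flipVar X (flipSet Z f)) w ≟ᵇ eval C (flipSet Z f) w))

allSubsets : ∀ n → List (Subset n)
allSubsets zero    = [] ∷ []
allSubsets (suc n) = map (true ∷_) (allSubsets n) ++ map (false ∷_) (allSubsets n)

minMaybe : Maybe ℕ → ℕ → Maybe ℕ
minMaybe nothing  k = just k
minMaybe (just j) k = just (j ⊓ k)

minWitnessSize : ∀ {n m} → Circuit n m → Fin n → Fin m → Assignment n → Maybe ℕ
minWitnessSize {n} C X w f = go (allSubsets n) nothing
  where
  go : List (Subset n) → Maybe ℕ → Maybe ℕ
  go []       acc = acc
  go (Z ∷ Zs) acc with makesCritical? C X w f Z
  ... | yes _ = go Zs (minMaybe acc ∣ Z ∣)
  ... | no  _ = go Zs acc

dr : ∀ {n m} → Circuit n m → Fin n → Fin m → Assignment n → ℚ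
dr C X w f with minWitnessSize C X w f
... | nothing = 0ℚ
... | just k  = (+ 1) / suc k

{-# OPTIONS --safe #-}
-- In a monotone circuit, flipping a single variable X moves every gate in the
-- same direction as X.  Hence if X is critical for w under an assignment g, the
-- gate w must take the value g(X).  A set Z with X ∉ Z leaves X unchanged and,
-- to make X critical, must also leave w unchanged; so f(w) = f(X) whenever such
-- a Z exists, and otherwise the search for a minimal Z finds nothing.
module Submission where

open import Defs
open import Data.Nat using (ℕ)
open import Data.Fin using (Fin; zero; suc; _≟_)
open import Data.Rational using (0ℚ)
open import Data.Bool using (true; false; _∧_; _∨_; _xor_; _≤_; f≤t; b≤b)
open import Data.Bool.Properties using (≤-minimum; ≤-maximum; ¬-not; xor-identityʳ)
open import Data.Vec.Properties using (lookup⇒[]=)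
open import Data.Vec.Functional.Relation.Binary.Pointwise using (Pointwise)
open import Data.List using (List; []; _∷_)
open import Data.Maybe using (Maybe; nothing)
open import Data.Product using (_,_)
open import Data.Fin.Subset using (Subset; _∉_)
open import Function using (_∘_)
open import Relation.Nullary using (Dec; yes; no; ¬_; contradiction)
open import Relation.Unary using (Decidable)
open import Relation.Binary.PropositionalEquality
  using (_≡_; _≢_; refl; sym; trans; cong; module ≡-Reasoning)

∧-mono-≤ : ∀ {a b c d} → a ≤ b → c ≤ d → a ∧ c ≤ b ∧ d
∧-mono-≤ f≤t         _   = ≤-minimum _
∧-mono-≤ {false} b≤b _   = b≤b
∧-mono-≤ {true}  b≤b c≤d = c≤d

∨-mono-≤ : ∀ {a b c d} → a ≤ b → c ≤ d → a ∨ c ≤ b ∨ d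
∨-mono-≤ f≤t         _   = ≤-maximum _
∨-mono-≤ {false} b≤b c≤d = c≤d
∨-mono-≤ {true}  b≤b _   = b≤b

≤∧≢⇒ʳ≡true : ∀ {a b} → a ≤ b → a ≢ b → b ≡ true
≤∧≢⇒ʳ≡true f≤t _   = refl
≤∧≢⇒ʳ≡true b≤b a≢a = contradiction refl a≢a

≤∧≢⇒ˡ≡false : ∀ {a b} → a ≤ b → a ≢ b → a ≡ false
≤∧≢⇒ˡ≡false f≤t _   = refl
≤∧≢⇒ˡ≡false b≤b a≢a = contradiction refl a≢a

eval-mono : ∀ {n m} (C : Circuit n m) {f g : Assignment n} →
  Pointwise _≤_ f g → Pointwise _≤_ (eval C f) (eval C g)
eval-mono (C ▷ input x) f≤g zero    = f≤g x
eval-mono (C ▷ and a b) f≤g zero    = ∧-mono-≤ (eval-mono C f≤g a) (eval-mono C f≤g b)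
eval-mono (C ▷ or a b)  f≤g zero    = ∨-mono-≤ (eval-mono C f≤g a) (eval-mono C f≤g b)
eval-mono (C ▷ _)       f≤g (suc w) = eval-mono C f≤g w

module _ {n} {X : Fin n} {g : Assignment n} where

  flipVar-≤ : g X ≡ true → Pointwise _≤_ (flipVar X g) g
  flipVar-≤ gX≡true i with X ≟ i
  ... | yes refl rewrite gX≡true = f≤t
  ... | no  _    = b≤b

  flipVar-≥ : g X ≡ false → Pointwise _≤_ g (flipVar X g)
  flipVar-≥ gX≡false i with X ≟ i
  ... | yes refl rewrite gX≡false = f≤t
  ... | no  _    = b≤b

critical⇒eval≡input : ∀ {n m} (C : Circuit n m) {X w g} →
  Critical C X w g → eval C g w ≡ g X
critical⇒eval≡input C {X} {w} {g} crit with g X in gX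
... | true  = ≤∧≢⇒ʳ≡true  (eval-mono C (flipVar-≤ gX) w) crit
... | false = ≤∧≢⇒ˡ≡false (eval-mono C (flipVar-≥ gX) w) (crit ∘ sym)

flipSet-∉ : ∀ {n} {X : Fin n} {Z : Subset n} (f : Assignment n) →
  X ∉ Z → flipSet Z f X ≡ f X
flipSet-∉ {X = X} {Z} f X∉Z =
  trans (cong (f X xor_) (¬-not (X∉Z ∘ lookup⇒[]= X Z))) (xor-identityʳ (f X))

makesCritical⇒eval≡input : ∀ {n m} (C : Circuit n m) X w f {Z} →
  MakesCritical C X w f Z → eval C f w ≡ f X
makesCritical⇒eval≡input C X w f {Z} (X∉Z , unchanged , critical) = begin
  eval C f w             ≡⟨ sym unchanged ⟩
  eval C (flipSet Z f) w ≡⟨ critical⇒eval≡input C critical ⟩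
  flipSet Z f X          ≡⟨ flipSet-∉ f X∉Z ⟩
  f X                    ∎
  where open ≡-Reasoning

scan-without-hits : ∀ {A B : Set} {P : A → Set} (P? : Decidable P) → (∀ x → ¬ P x) →
  (b : B) (step : (x : A) → List A → Dec (P x) → B) →
  (∀ x ¬p → step x [] (no ¬p) ≡ b) →
  (∀ x ¬p y ys → step x (y ∷ ys) (no ¬p) ≡ step y ys (P? y)) →
  ∀ x xs d → step x xs d ≡ b
scan-without-hits P? none b step end next x xs       (yes p) = contradiction p (none x)
scan-without-hits P? none b step end next x []       (no ¬p) = end x ¬p
scan-without-hits P? none b step end next x (y ∷ ys) (no ¬p) =
  trans (next x ¬p y ys) (scan-without-hits P? none b step end next y ys (P? y))

-- The search loop of minWitnessSize is local to Defs, so the with-function it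
-- steps through cannot be named here: searchStep is left for Agda to infer
-- from its use in minWitnessSize≡nothing, after which both equations of
-- scan-without-hits hold by refl.
mutual
  searchStep : ∀ {n m} (C : Circuit n m) X w f (Z : Subset n) →
    List (Subset n) → Dec (MakesCritical C X w f Z) → Maybe ℕ
  searchStep = _

  minWitnessSize≡nothing : ∀ {n m} (C : Circuit n m) X w f →
    (∀ Z → ¬ MakesCritical C X w f Z) → minWitnessSize C X w f ≡ nothing
  minWitnessSize≡nothing {n} C X w f none with allSubsets n
  ... | []     = refl
  ... | Z ∷ Zs with makesCritical? C X w f Z
  ...   | d = scan-without-hits (makesCritical? C X w f) none nothing (searchStep C X w f)
                (λ _ _ → refl) (λ _ _ _ _ → refl) Z Zs d

lemma1 : ∀ {n m} (C : Circuit n m) (X : Fin n) (w : Fin m) (f : Assignment n) →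
    eval C f w ≢ f X → dr C X w f ≡ 0ℚ
lemma1 C X w f fw≢fX
  rewrite minWitnessSize≡nothing C X w f (λ _ → fw≢fX ∘ makesCritical⇒eval≡input C X w f)
  = refl
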